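{- A tournament is a lexicographical sum of acyclic tournaments indexed by a finite tournament if and only if it has only finitely many acyclic components.
   Context: A tournament is a set with an irreflexive, antisymmetric, complete binary relation; acyclic means no $3$-cycle. A subset $A$ of vertices is autonomous if for all $x,x'\in A$ and $y\notin A$, $(x,y)$ is an edge iff $(x',y)$ is an edge. The acyclic component of a vertex $x$ is the union of all acyclic autonomous subsets containing $x$. Lexicographical sum $\sum_{i\in D}T_i$: vertex set the disjoint union of the $V(T_i)$, with $(x,i)\to(y,j)$ iff ($i=j$ and $x\to y$ in $T_i$) or $i\to j$ in $D$. -}

module Defs where

open import Level using (Level; 0ℓ)
open import Data.Nat using (ℕ)
open import Data.Fin using (Fin)
open import Data.Product using (Σ; ∃; ∃-syntax; _×_; _,_)
open import Data.Sum using (_⊎_)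
open import Data.Empty using (⊥)
open import Relation.Nullary using (¬_)
open import Relation.Binary.PropositionalEquality using (_≡_; _≢_)
open import Function.Bundles using (_⇔_; _↔_; Inverse)

record Tournament (V : Set) : Set₁ where
  field
    _⇒_     : V → V → Set
    irrefl  : ∀ x → ¬ (x ⇒ x)
    antisym : ∀ x y → x ⇒ y → y ⇒ x → ⊥
    total   : ∀ x y → x ≢ y → (x ⇒ y) ⊎ (y ⇒ x)

open Tournament public

Subset : Set → Set₁
Subset V = V → Set

module _ {V : Set} (T : Tournament V) where

  private
    _⟶_ = _⇒_ T

  ThreeCycle : V → V → V → Set
  ThreeCycle x y z = (x ⟶ y) × (y ⟶ z) × (z ⟶ x)

  Acyclic : Set
  Acyclic = ∀ x y z → ¬ ThreeCycle x y z

  AcyclicSubset : Subset V → Set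
  AcyclicSubset A = ∀ x y z → A x → A y → A z → ¬ ThreeCycle x y z

  Autonomous : Subset V → Set
  Autonomous A = ∀ x x' y → A x → A x' → ¬ A y → ((x ⟶ y) ⇔ (x' ⟶ y))

  -- the acyclic component of x: the union of all acyclic autonomous
  -- subsets containing x
  AcyclicComponent : V → V → Set₁
  AcyclicComponent x y =
    Σ (Subset V) λ A → Autonomous A × AcyclicSubset A × A x × A y

  FinitelyManyAcyclicComponents : Set₁
  FinitelyManyAcyclicComponents =
    Σ ℕ λ n → Σ (Fin n → V) λ rep → ∀ x → Σ (Fin n) λ i →
      ∀ y → AcyclicComponent x y ⇔ AcyclicComponent (rep i) y

data LexEdge {n : ℕ} (D : Tournament (Fin n)) {W : Fin n → Set}
             (Ts : (i : Fin n) → Tournament (W i)) :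
             Σ (Fin n) W → Σ (Fin n) W → Set where
  inside : ∀ {i x y} → _⇒_ (Ts i) x y → LexEdge D Ts (i , x) (i , y)
  across : ∀ {i j x y} → _⇒_ D i j → LexEdge D Ts (i , x) (j , y)

-- T is (isomorphic to) a lexicographical sum of acyclic tournaments indexed
-- by a finite tournament.  A finite tournament is represented (up to
-- isomorphism) by a tournament on Fin n.
IsLexSumOfAcyclicOverFinite : {V : Set} → Tournament V → Set₁
IsLexSumOfAcyclicOverFinite {V} T =
  Σ ℕ λ n → Σ (Tournament (Fin n)) λ D →
  Σ (Fin n → Set) λ W → Σ ((i : Fin n) → Tournament (W i)) λ Ts →
  ((i : Fin n) → Acyclic (Ts i)) ×
  Σ (V ↔ Σ (Fin n) W) λ f →
    ∀ x y → (_⇒_ T x y ⇔ LexEdge D Ts (Inverse.to f x) (Inverse.to f y))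

-- Two acyclic autonomous sets with a common vertex have an acyclic autonomous
-- union, because a 3-cycle with two vertices in an autonomous set has all
-- three there.  Hence "lying in a common acyclic autonomous set" is an
-- equivalence relation whose classes are the acyclic components; each class
-- is acyclic, and edges between two different classes all point the same way.
-- So with finitely many components, the tournament is the lexicographical sum
-- of its components over the finite tournament they induce.  Conversely, each
-- summand of such a sum is acyclic and autonomous, so it lies in a single
-- component, and the finitely many summands meet every component.
module Submission where

open import Defs
open import Level using (0ℓ; suc)
open import Function using (_∘_)
open import Function.Bundles using (_⇔_; _↔_; Inverse; Equivalence; mk⇔; mk↔ₛ′)
open import Function.Construct.Composition using (_⇔-∘_)
open import Function.Construct.Symmetry using (⇔-sym)
open import Function.Definitions using (Injective)
open import Axiom.ExcludedMiddle using (ExcludedMiddle)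
open import Axiom.UniquenessOfIdentityProofs using (module Decidable⇒UIP)
open import Data.Nat using (ℕ)
import Data.Nat.Properties as ℕ
open import Data.Fin using (Fin; _<_; _≤_; fromℕ<; inject)
open import Data.Fin.Properties
  using (_≟_; _<?_; <-cmp; <-asym; ≤-antisym; toℕ-injective; toℕ-inject; toℕ-fromℕ<; ¬∀⟶∃¬-smallest)
open import Data.Product using (Σ; ∃; _×_; _,_; proj₁; proj₂)
open import Data.Sum using (_⊎_; inj₁; inj₂)
open import Data.Empty using (⊥; ⊥-elim)
open import Relation.Nullary using (¬_; yes; no; ¬?; contradiction)
open import Relation.Nullary.Decidable using (decidable-stable)
open import Relation.Unary using (Pred; Decidable; ∁; _∪_)
open import Relation.Binary.PropositionalEquality using (_≡_; _≢_; refl; sym; trans; cong; subst)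
open import Relation.Binary.Definitions using (tri<; tri≈; tri>)

least : ∀ {n p} {P : Pred (Fin n) p} → Decidable P → ∃ P → ∃ λ i → P i × (∀ j → P j → i ≤ j)
least {n} {P = P} P? (j , Pj) with ¬∀⟶∃¬-smallest n (∁ P) (¬? ∘ P?) (λ ∀¬P → ∀¬P j Pj)
... | i , ¬¬Pi , below = i , decidable-stable (P? i) ¬¬Pi , minimal
  where
  minimal : ∀ k → P k → i ≤ k
  minimal k Pk with k <? i
  ... | no k≮i = ℕ.≮⇒≥ k≮i
  ... | yes k<i = contradiction (subst P (sym inject-k) Pk) (below (fromℕ< k<i))
    where
    inject-k : inject (fromℕ< k<i) ≡ k
    inject-k = toℕ-injective (trans (toℕ-inject (fromℕ< k<i)) (toℕ-fromℕ< k<i))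

induced : ∀ {U V : Set} → Tournament V → (ι : U → V) → Injective _≡_ _≡_ ι → Tournament U
induced T ι ι-injective = record
  { _⇒_     = λ u u′ → _⇒_ T (ι u) (ι u′)
  ; irrefl  = irrefl T ∘ ι
  ; antisym = λ u u′ → antisym T (ι u) (ι u′)
  ; total   = λ u u′ u≢u′ → total T (ι u) (ι u′) (u≢u′ ∘ ι-injective)
  }

module _ {n : ℕ} {D : Tournament (Fin n)} {W : Fin n → Set}
         {Ts : (i : Fin n) → Tournament (W i)} where

  LexEdge-across : ∀ {p q} → proj₁ p ≢ proj₁ q → LexEdge D Ts p q → _⇒_ D (proj₁ p) (proj₁ q)
  LexEdge-across i≢i (inside _) = contradiction refl i≢i
  LexEdge-across _   (across e) = e

  LexEdge-inside : ∀ {i a b} → LexEdge D Ts (i , a) (i , b) → _⇒_ (Ts i) a b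
  LexEdge-inside     (inside e) = e
  LexEdge-inside {i} (across e) = ⊥-elim (irrefl D i e)

  LexEdge-acyclic-summand : ∀ {i} → Acyclic (Ts i) → ∀ {p q r} →
    proj₁ p ≡ i → proj₁ q ≡ i → proj₁ r ≡ i →
    ¬ (LexEdge D Ts p q × LexEdge D Ts q r × LexEdge D Ts r p)
  LexEdge-acyclic-summand acyclic {_ , a} {_ , b} {_ , c} refl refl refl (pq , qr , rp) =
    acyclic a b c (LexEdge-inside pq , LexEdge-inside qr , LexEdge-inside rp)

module AcyclicComponents {V : Set} (T : Tournament V) where

  private
    _⟶_ = _⇒_ T
    _~_ = AcyclicComponent T

  autonomous-out : ∀ {A x x′ y} → Autonomous T A → A x → A x′ → ¬ A y → x ⟶ y → x′ ⟶ y
  autonomous-out aut Ax Ax′ ¬Ay = Equivalence.to (aut _ _ _ Ax Ax′ ¬Ay)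

  autonomous-in : ∀ {A x x′ y} → Autonomous T A → A x → A x′ → ¬ A y → y ⟶ x → y ⟶ x′
  autonomous-in {x = x} {x′} {y} aut Ax Ax′ ¬Ay yx with total T y x′ (λ { refl → ¬Ay Ax′ })
  ... | inj₁ yx′ = yx′
  ... | inj₂ x′y = ⊥-elim (antisym T x y (autonomous-out aut Ax′ Ax ¬Ay x′y) yx)

  autonomous-cycle : ∀ {A x y z} → Autonomous T A → A x → A y → ThreeCycle T x y z → ¬ ¬ A z
  autonomous-cycle {x = x} {z = z} aut Ax Ay (_ , yz , zx) ¬Az =
    antisym T x z (autonomous-out aut Ay Ax ¬Az yz) zx

  acyclic-autonomous-cycle : ∀ {A x y z} → Autonomous T A → AcyclicSubset T A →
    A x → A y → ¬ ThreeCycle T x y z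
  acyclic-autonomous-cycle aut acyclic Ax Ay cycle =
    autonomous-cycle aut Ax Ay cycle (λ Az → acyclic _ _ _ Ax Ay Az cycle)

  rotate : ∀ {x y z} → ThreeCycle T x y z → ThreeCycle T y z x
  rotate (xy , yz , zx) = yz , zx , xy

  ∪-autonomous : ∀ {A B x} → Autonomous T A → Autonomous T B → A x → B x → Autonomous T (A ∪ B)
  ∪-autonomous {A} {B} {x} autA autB Ax Bx y y′ z y∈ y′∈ z∉ = ⇔-sym (via y′ y′∈) ⇔-∘ via y y∈
    where
    via : ∀ w → (A ∪ B) w → (w ⟶ z) ⇔ (x ⟶ z)
    via w (inj₁ Aw) = autA w x z Aw Ax (z∉ ∘ inj₁)
    via w (inj₂ Bw) = autB w x z Bw Bx (z∉ ∘ inj₂)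

  -- Two of the three vertices of a cycle lie in the same set.
  ∪-acyclic : ∀ {A B} → Autonomous T A → AcyclicSubset T A → Autonomous T B → AcyclicSubset T B →
    AcyclicSubset T (A ∪ B)
  ∪-acyclic {A} {B} autA acA autB acB x y z = cases
    where
    inA : ∀ {u v w} → A u → A v → ¬ ThreeCycle T u v w
    inA = acyclic-autonomous-cycle autA acA
    inB : ∀ {u v w} → B u → B v → ¬ ThreeCycle T u v w
    inB = acyclic-autonomous-cycle autB acB
    cases : (A ∪ B) x → (A ∪ B) y → (A ∪ B) z → ¬ ThreeCycle T x y z
    cases (inj₁ Ax) (inj₁ Ay) _         cycle = inA Ax Ay cycle
    cases (inj₂ Bx) (inj₂ By) _         cycle = inB Bx By cycle
    cases (inj₁ Ax) (inj₂ _)  (inj₁ Az) cycle = inA Az Ax (rotate (rotate cycle))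
    cases (inj₁ _)  (inj₂ By) (inj₂ Bz) cycle = inB By Bz (rotate cycle)
    cases (inj₂ _)  (inj₁ Ay) (inj₁ Az) cycle = inA Ay Az (rotate cycle)
    cases (inj₂ Bx) (inj₁ _)  (inj₂ Bz) cycle = inB Bz Bx (rotate (rotate cycle))

  ~-refl : ∀ {x} → x ~ x
  ~-refl {x} = (_≡ x) , autonomous , acyclic , refl , refl
    where
    autonomous : Autonomous T (_≡ x)
    autonomous _ _ _ refl refl _ = mk⇔ (λ e → e) (λ e → e)
    acyclic : AcyclicSubset T (_≡ x)
    acyclic _ _ _ refl refl refl (xx , _) = irrefl T x xx

  ~-sym : ∀ {x y} → x ~ y → y ~ x
  ~-sym (A , aut , acyclic , Ax , Ay) = A , aut , acyclic , Ay , Ax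

  ~-trans : ∀ {x y z} → x ~ y → y ~ z → x ~ z
  ~-trans (A , autA , acA , Ax , Ay) (B , autB , acB , By , Bz) =
    A ∪ B , ∪-autonomous autA autB Ay By , ∪-acyclic autA acA autB acB , inj₁ Ax , inj₂ Bz

  ~-acyclic : ∀ {x y z} → x ~ y → x ~ z → ¬ ThreeCycle T x y z
  ~-acyclic (A , autA , acA , Ax , Ay) (B , autB , acB , Bx , Bz) =
    ∪-acyclic autA acA autB acB _ _ _ (inj₁ Ax) (inj₁ Ay) (inj₂ Bz)

  ~-uniform : ∀ {a a′ b b′} → a ~ a′ → b ~ b′ → ¬ a ~ b → a ⟶ b → a′ ⟶ b′
  ~-uniform a~a′@(A , autA , acA , Aa , Aa′) (B , autB , acB , Bb , Bb′) a≁b ab =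
    autonomous-in autB Bb Bb′ a′∉B (autonomous-out autA Aa Aa′ b∉A ab)
    where
    b∉A : ¬ A _
    b∉A Ab = a≁b (A , autA , acA , Aa , Ab)
    a′∉B : ¬ B _
    a′∉B Ba′ = a≁b (~-trans a~a′ (~-sym (B , autB , acB , Bb , Ba′)))

  ~-classes : ∀ {x x′} → x ~ x′ → ∀ y → (x ~ y) ⇔ (x′ ~ y)
  ~-classes x~x′ _ = mk⇔ (~-trans (~-sym x~x′)) (~-trans x~x′)

module LexSumComponents (em : ExcludedMiddle 0ℓ) {V : Set} (T : Tournament V)
  {n : ℕ} (D : Tournament (Fin n)) {W : Fin n → Set} (Ts : (i : Fin n) → Tournament (W i))
  (f : V ↔ Σ (Fin n) W) (edges : ∀ x y → _⇒_ T x y ⇔ LexEdge D Ts (Inverse.to f x) (Inverse.to f y))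
  where

  open AcyclicComponents T
  open Inverse f using (to; from; strictlyInverseˡ)

  index : V → Fin n
  index = proj₁ ∘ to

  Summand : Fin n → Subset V
  Summand i v = index v ≡ i

  summand-autonomous : ∀ i → Autonomous T (Summand i)
  summand-autonomous i u u′ z u∈ u′∈ z∉ = mk⇔ (move u∈ u′∈) (move u′∈ u∈)
    where
    move : ∀ {w w′} → Summand i w → Summand i w′ → _⇒_ T w z → _⇒_ T w′ z
    move {w} {w′} w∈ w′∈ wz = Equivalence.from (edges w′ z) (across (subst (λ k → _⇒_ D k (index z))
      (trans w∈ (sym w′∈)) (LexEdge-across w≢z (Equivalence.to (edges w z) wz))))
      where
      w≢z : index w ≢ index z
      w≢z w≡z = z∉ (trans (sym w≡z) w∈)

  summand-acyclic : ∀ i → Acyclic (Ts i) → AcyclicSubset T (Summand i)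
  summand-acyclic i acyclic u v w u∈ v∈ w∈ (uv , vw , wu) =
    LexEdge-acyclic-summand acyclic u∈ v∈ w∈
      (Equivalence.to (edges u v) uv , Equivalence.to (edges v w) vw , Equivalence.to (edges w u) wu)

  finitelyMany : (∀ i → Acyclic (Ts i)) → FinitelyManyAcyclicComponents T
  finitelyMany acyclic with em {V}
  ... | no ¬v = 0 , (λ ()) , λ x → contradiction x ¬v
  ... | yes v = n , representative , λ x → index x , ~-classes (x~rep x)
    where
    representative : Fin n → V
    representative i with em {W i}
    ... | yes w = from (i , w)
    ... | no _  = v
    representative-index : ∀ i → W i → index (representative i) ≡ i
    representative-index i w with em {W i}
    ... | yes w′ = cong proj₁ (strictlyInverseˡ (i , w′))
    ... | no ¬w  = contradiction w ¬w
    x~rep : ∀ x → AcyclicComponent T x (representative (index x))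
    x~rep x = Summand (index x) , summand-autonomous (index x) , summand-acyclic (index x) (acyclic (index x))
            , refl , representative-index (index x) (proj₂ (to x))

module LexDecomposition (em : ExcludedMiddle 0ℓ) {V : Set} (T : Tournament V)
  {n : ℕ} (class : V → Fin n)
  (uniform : ∀ {a a′ b b′} → class a ≡ class a′ → class b ≡ class b′ → class a ≢ class b →
             _⇒_ T a b → _⇒_ T a′ b′)
  where

  private
    _⟶_ = _⇒_ T

  Fibre : Fin n → Set
  Fibre i = Σ V λ x → class x ≡ i

  fibre : (i : Fin n) → Tournament (Fibre i)
  fibre i = induced T proj₁ proj₁-injective
    where
    proj₁-injective : Injective _≡_ _≡_ proj₁
    proj₁-injective {x , p} {.x , q} refl = cong (x ,_) (Decidable⇒UIP.≡-irrelevant _≟_ p q)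

  CrossEdge : Fin n → Fin n → Set
  CrossEdge i j = Σ (Fibre i) λ a → Σ (Fibre j) λ b → proj₁ a ⟶ proj₁ b

  CrossEdge-uniform : ∀ {i j} → i ≢ j → CrossEdge i j → (a : Fibre i) (b : Fibre j) → proj₁ a ⟶ proj₁ b
  CrossEdge-uniform i≢j ((_ , refl) , (_ , refl) , e) (_ , a′∈) (_ , b′∈) =
    uniform (sym a′∈) (sym b′∈) i≢j e

  -- Between an empty class and any other class the direction is arbitrary;
  -- the order of indices fixes it.
  _⇒Q_ : Fin n → Fin n → Set
  i ⇒Q j = i ≢ j × (CrossEdge i j ⊎ (¬ (Fibre i × Fibre j) × i < j))

  quotient : Tournament (Fin n)
  quotient = record { _⇒_ = _⇒Q_ ; irrefl = λ i i⇒i → proj₁ i⇒i refl ; antisym = anti ; total = tot }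
    where
    anti : ∀ i j → i ⇒Q j → j ⇒Q i → ⊥
    anti i j (i≢j , inj₁ e) (_ , inj₁ (b , a , ba)) = antisym T _ _ (CrossEdge-uniform i≢j e a b) ba
    anti i j (_ , inj₁ (a , b , _)) (_ , inj₂ (¬ba , _)) = ¬ba (b , a)
    anti i j (_ , inj₂ (¬ab , _)) (_ , inj₁ (b , a , _)) = ¬ab (a , b)
    anti i j (_ , inj₂ (_ , i<j)) (_ , inj₂ (_ , j<i)) = <-asym i<j j<i
    tot : ∀ i j → i ≢ j → (i ⇒Q j) ⊎ (j ⇒Q i)
    tot i j i≢j with em {Fibre i × Fibre j}
    ... | yes ((a , refl) , (b , refl)) with total T a b (i≢j ∘ cong class)
    ...   | inj₁ ab = inj₁ (i≢j , inj₁ ((a , refl) , (b , refl) , ab))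
    ...   | inj₂ ba = inj₂ (i≢j ∘ sym , inj₁ ((b , refl) , (a , refl) , ba))
    tot i j i≢j | no ¬ab with <-cmp i j
    ...   | tri< i<j _ _ = inj₁ (i≢j , inj₂ (¬ab , i<j))
    ...   | tri≈ _ i≡j _ = contradiction i≡j i≢j
    ...   | tri> _ _ j<i = inj₂ (i≢j ∘ sym , inj₂ ((λ { (b , a) → ¬ab (a , b) }) , j<i))

  fibration : V ↔ Σ (Fin n) Fibre
  fibration = mk↔ₛ′ (λ x → class x , x , refl) (proj₁ ∘ proj₂)
                     (λ { (_ , _ , refl) → refl }) (λ _ → refl)

  lexEdge : ∀ (p q : Σ (Fin n) Fibre) →
    (proj₁ (proj₂ p) ⟶ proj₁ (proj₂ q)) ⇔ LexEdge quotient fibre p q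
  lexEdge p q = mk⇔ (toLex p q) fromLex
    where
    toLex : ∀ p q → proj₁ (proj₂ p) ⟶ proj₁ (proj₂ q) → LexEdge quotient fibre p q
    toLex (i , a) (j , b) e with i ≟ j
    ... | yes refl = inside e
    ... | no i≢j   = across (i≢j , inj₁ (a , b , e))
    fromLex : ∀ {p q} → LexEdge quotient fibre p q → proj₁ (proj₂ p) ⟶ proj₁ (proj₂ q)
    fromLex (inside e) = e
    fromLex {_ , a} {_ , b} (across (i≢j , inj₁ e))        = CrossEdge-uniform i≢j e a b
    fromLex {_ , a} {_ , b} (across (_   , inj₂ (¬ab , _))) = contradiction (a , b) ¬ab

  isLexSum : (∀ {x y z} → class x ≡ class y → class x ≡ class z → ¬ ThreeCycle T x y z) →
    IsLexSumOfAcyclicOverFinite T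
  isLexSum acyclic = n , quotient , Fibre , fibre , fibre-acyclic , fibration
                   , λ x y → lexEdge (Inverse.to fibration x) (Inverse.to fibration y)
    where
    fibre-acyclic : ∀ i → Acyclic (fibre i)
    fibre-acyclic i (_ , x∈) (_ , y∈) (_ , z∈) = acyclic (trans x∈ (sym y∈)) (trans x∈ (sym z∈))

module ComponentClassification (em₁ : ExcludedMiddle (suc 0ℓ)) (em₀ : ExcludedMiddle 0ℓ)
  {V : Set} (T : Tournament V) {n : ℕ} (representative : Fin n → V)
  (covers : ∀ x → ∃ λ i → AcyclicComponent T x (representative i))
  where

  open AcyclicComponents T
  private
    _~_ = AcyclicComponent T
    leastRepresentative : ∀ x → ∃ λ i → x ~ representative i × (∀ j → x ~ representative j → i ≤ j)
    leastRepresentative x = least (λ _ → em₁) (covers x)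

  -- The least index of a representative of x's component; minimality makes it
  -- depend only on the component.
  class : V → Fin n
  class x = proj₁ (leastRepresentative x)

  class-sound : ∀ x → x ~ representative (class x)
  class-sound x = proj₁ (proj₂ (leastRepresentative x))

  class-minimal : ∀ {x} j → x ~ representative j → class x ≤ j
  class-minimal {x} = proj₂ (proj₂ (leastRepresentative x))

  ~⇒class≡ : ∀ {x y} → x ~ y → class x ≡ class y
  ~⇒class≡ {x} {y} x~y = ≤-antisym (class-minimal _ (~-trans x~y (class-sound y)))
                                   (class-minimal _ (~-trans (~-sym x~y) (class-sound x)))

  class≡⇒~ : ∀ {x y} → class x ≡ class y → x ~ y
  class≡⇒~ {x} {y} eq =
    ~-trans (class-sound x) (~-sym (subst (λ k → y ~ representative k) (sym eq) (class-sound y)))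

  isLexSum : IsLexSumOfAcyclicOverFinite T
  isLexSum = LexDecomposition.isLexSum em₀ T class
    (λ a≡a′ b≡b′ a≢b → ~-uniform (class≡⇒~ a≡a′) (class≡⇒~ b≡b′) (a≢b ∘ ~⇒class≡))
    (λ x≡y x≡z → ~-acyclic (class≡⇒~ x≡y) (class≡⇒~ x≡z))

proposition3p5 : ExcludedMiddle (suc 0ℓ) → ExcludedMiddle 0ℓ →
    {V : Set} (T : Tournament V) →
    IsLexSumOfAcyclicOverFinite T ⇔ FinitelyManyAcyclicComponents T
proposition3p5 em₁ em₀ T = mk⇔ finitelyMany lexSum
  where
  open AcyclicComponents T using (~-refl)
  finitelyMany : IsLexSumOfAcyclicOverFinite T → FinitelyManyAcyclicComponents T
  finitelyMany (_ , D , _ , Ts , acyclic , f , edges) =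
    LexSumComponents.finitelyMany em₀ T D Ts f edges acyclic
  lexSum : FinitelyManyAcyclicComponents T → IsLexSumOfAcyclicOverFinite T
  lexSum (_ , representative , same) = ComponentClassification.isLexSum em₁ em₀ T representative
    (λ x → proj₁ (same x) , Equivalence.from (proj₂ (same x) _) ~-refl)
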